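{- Let $G$ be a finite connected graph and let $D$ be an induced subgraph of $G$ which is a terminal block of $G$ isomorphic to a diamond. Then $D$ is a $(3,\varepsilon,\alpha)$-reducible subgraph of $G$ for all values $0<\varepsilon\le\alpha\le\tfrac13$.
   Context: A diamond is a graph on four vertices with exactly five edges ($K_4$ minus an edge). For a connected graph $G$, a block is a maximal connected induced subgraph with no cut vertex, and a terminal block is a block containing at most one cut vertex of $G$. A $3$-assignment $L$ on $G$ maps each vertex to a set of $3$ colors; an $L$-coloring is a proper coloring with $\phi(v)\in L(v)$. For $0<\varepsilon\le\alpha$, a distribution on $L$-colorings $\phi$ of $G$ is a $(3,\varepsilon,\alpha)$-distribution if $\Pr(\phi(v)=c)\ge\varepsilon$ for all $v$, $c\in L(v)$, and $\Pr(\phi(u)\ne c)\ge\alpha$ for every vertex $u$ and color $c$. An induced subgraph $H$ of $G$ is a $(3,\varepsilon,\alpha)$-reducible subgraph of $G$ if there is a nonempty $S\subseteq V(H)$ such that for every $3$-assignment $L$ on $G$, the existence of a $(3,\varepsilon,\alpha)$-distribution on $L$-colorings of $G\setminus S$ implies the existence of a $(3,\varepsilon,\alpha)$-distribution on $L$-colorings of $G$.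
   Formalization: The parameters ε and α are rational, and every distribution on L-colorings has rational probabilities. -}

module Defs where

open import Data.Nat using (ℕ; zero; suc; _≡ᵇ_)
open import Data.Bool using (Bool; true; false; not; _∧_)
open import Data.Fin using (Fin; toℕ)
open import Data.Fin.Properties using () renaming (_≟_ to _≟F_)
open import Data.List using (List; []; _∷_; length)
open import Data.List.Membership.Propositional using (_∈_)
open import Data.List.Relation.Unary.Unique.Propositional using (Unique)
open import Data.List.Relation.Unary.All using (All)
open import Data.Product using (Σ; _×_; _,_; proj₁; proj₂; ∃-syntax)
open import Data.Integer using (+_)
open import Data.Rational using (ℚ; 0ℚ; _+_; _≤_; _<_; _/_)
open import Relation.Binary.PropositionalEquality using (_≡_; _≢_)
open import Relation.Nullary using (¬_; Dec; yes; no)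
open import Relation.Nullary.Decidable using (⌊_⌋)
open import Function.Definitions using (Injective)

record Graph (n : ℕ) : Set where
  field
    adj    : Fin n → Fin n → Bool
    sym    : ∀ u v → adj u v ≡ adj v u
    irrefl : ∀ v → adj v v ≡ false
open Graph public

-- vertex subsets (these determine induced subgraphs)
VSet : ℕ → Set
VSet n = Fin n → Bool

_∈V_ : ∀ {n} → Fin n → VSet n → Set
v ∈V X = X v ≡ true

_⊆V_ : ∀ {n} → VSet n → VSet n → Set
X ⊆V Y = ∀ v → v ∈V X → v ∈V Y

allV : ∀ {n} → VSet n
allV _ = true

_─_ : ∀ {n} → VSet n → Fin n → VSet n
(X ─ v) u = X u ∧ not ⌊ u ≟F v ⌋

_∖_ : ∀ {n} → VSet n → VSet n → VSet n
(X ∖ S) u = X u ∧ not (S u)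

data Walk {n} (G : Graph n) (X : VSet n) : Fin n → Fin n → Set where
  here : ∀ {v} → v ∈V X → Walk G X v v
  step : ∀ {u w v} → u ∈V X → adj G u w ≡ true → Walk G X w v → Walk G X u v

-- G[X] is connected (the empty graph counts as connected)
ConnectedOn : ∀ {n} → Graph n → VSet n → Set
ConnectedOn G X = ∀ u v → u ∈V X → v ∈V X → Walk G X u v

Connected : ∀ {n} → Graph n → Set
Connected G = ConnectedOn G allV

NoCutVertexOn : ∀ {n} → Graph n → VSet n → Set
NoCutVertexOn G X = ∀ v → v ∈V X → ConnectedOn G (X ─ v)

IsCutVertex : ∀ {n} → Graph n → Fin n → Set
IsCutVertex G v = ¬ ConnectedOn G (allV ─ v)

IsBlock : ∀ {n} → Graph n → VSet n → Set
IsBlock G X =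
  ConnectedOn G X × NoCutVertexOn G X ×
  (∀ Y → X ⊆V Y → ConnectedOn G Y → NoCutVertexOn G Y → Y ⊆V X)

IsTerminalBlock : ∀ {n} → Graph n → VSet n → Set
IsTerminalBlock G X =
  IsBlock G X ×
  (∀ u v → u ∈V X → v ∈V X → IsCutVertex G u → IsCutVertex G v → u ≡ v)

diamondAdjℕ : ℕ → ℕ → Bool
diamondAdjℕ 0 3 = false
diamondAdjℕ 3 0 = false
diamondAdjℕ i j = not (i ≡ᵇ j)

diamondAdj : Fin 4 → Fin 4 → Bool
diamondAdj i j = diamondAdjℕ (toℕ i) (toℕ j)

IsDiamond : ∀ {n} → Graph n → VSet n → Set
IsDiamond {n} G X = Σ (Fin 4 → Fin n) λ f →
  Injective _≡_ _≡_ f ×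
  (∀ i → f i ∈V X) ×
  (∀ v → v ∈V X → ∃[ i ] f i ≡ v) ×
  (∀ i j → adj G (f i) (f j) ≡ diamondAdj i j)

record Assignment3 (n : ℕ) : Set where
  field
    lists    : Fin n → List ℕ
    size3    : ∀ v → length (lists v) ≡ 3
    distinct : ∀ v → Unique (lists v)
open Assignment3 public

Coloring : ℕ → Set
Coloring n = Fin n → ℕ

IsLColoringOn : ∀ {n} → Graph n → Assignment3 n → VSet n → Coloring n → Set
IsLColoringOn G L X φ =
  (∀ v → v ∈V X → φ v ∈ lists L v) ×
  (∀ u v → u ∈V X → v ∈V X → adj G u v ≡ true → φ u ≢ φ v)

Weighted : ℕ → Set
Weighted n = List (ℚ × Coloring n)

totalWeight : ∀ {n} → Weighted n → ℚ
totalWeight []            = 0ℚ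
totalWeight ((w , _) ∷ d) = w + totalWeight d

Pr : ∀ {n} → Weighted n → (Coloring n → Bool) → ℚ
Pr []            e = 0ℚ
Pr ((w , φ) ∷ d) e with e φ
... | true  = w + Pr d e
... | false = Pr d e

record DistOn {n} (G : Graph n) (L : Assignment3 n) (X : VSet n) : Set where
  field
    support    : Weighted n
    nonneg     : All (λ p → 0ℚ ≤ proj₁ p) support
    sumOne     : totalWeight support ≡ + 1 / 1
    colorings  : All (λ p → IsLColoringOn G L X (proj₂ p)) support
open DistOn public

Is3Dist : ∀ {n} {G : Graph n} {L : Assignment3 n} {X : VSet n} →
          ℚ → ℚ → DistOn G L X → Set
Is3Dist {n} {G} {L} {X} ε α D =
  (∀ v c → v ∈V X → c ∈ lists L v →
     ε ≤ Pr (support D) (λ φ → φ v ≡ᵇ c)) ×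
  (∀ u c → u ∈V X →
     α ≤ Pr (support D) (λ φ → not (φ u ≡ᵇ c)))

Has3Dist : ∀ {n} → Graph n → Assignment3 n → VSet n → ℚ → ℚ → Set
Has3Dist G L X ε α = Σ (DistOn G L X) (Is3Dist ε α)

IsReducible : ∀ {n} → Graph n → VSet n → ℚ → ℚ → Set
IsReducible G H ε α = Σ (VSet _) λ S →
  S ⊆V H × (∃[ v ] v ∈V S) ×
  (∀ (L : Assignment3 _) → Has3Dist G L (allV ∖ S) ε α → Has3Dist G L allV ε α)

-- Only one vertex x of the diamond D can have neighbors outside D: a vertex of a block with an
-- outside neighbor w is a cut vertex (otherwise a path from w back into D avoiding it would be an
-- ear, and D together with that ear would be a larger 2-connected subgraph), and a terminal block
-- contains at most one cut vertex.  Remove S = D ∖ x.  For every 3-assignment the diamond has three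
-- pairwise disjoint L-colorings σ₀, σ₁, σ₂ which together exhaust every list: pair up the lists of
-- the two degree-3 vertices so that no two pairs use the same two colors, then each of the other
-- two vertices gets its colors by Hall's theorem.  Extend a coloring φ of G − S by the σᵢ with
-- σᵢ x = φ x.  Then "v ∈ D gets c" is the event "x gets σᵢ x" for the i with σᵢ v = c, so every
-- probability bound at v is inherited from x.

module Submission where

open import Defs hiding (sym)
open import Data.Bool using (Bool; true; false; not; _∨_)
open import Data.Bool.Properties using (∨-zeroʳ) renaming (_≟_ to _≟B_)
open import Data.Empty using (⊥-elim)
open import Data.Fin using (Fin)
open import Data.Fin.Patterns using (0F; 1F; 2F; 3F)
open import Data.Fin.Permutation using (Permutation′; _⟨$⟩ʳ_; _⟨$⟩ˡ_; inverseˡ; inverseʳ; id; transpose; _∘ₚ_)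
open import Data.Fin.Properties using (all?; any?) renaming (_≟_ to _≟F_)
open import Data.Integer using (+_)
open import Data.List using (List; []; _∷_; length; map)
open import Data.List.Membership.Propositional using (_∈_)
import Data.List.Membership.DecPropositional as DecMembership
open import Data.List.Relation.Unary.All using (All; []; _∷_)
import Data.List.Relation.Unary.All as All
open import Data.List.Relation.Unary.All.Properties using (map⁺)
open import Data.List.Relation.Unary.All.Properties.Core using (¬Any⇒All¬)
open import Data.List.Relation.Unary.AllPairs using (_∷_)
open import Data.List.Relation.Unary.Any using (Any; here; there; satisfied)
import Data.List.Relation.Unary.Any as Any
open import Data.List.Relation.Unary.Unique.Propositional using (Unique; [])
open import Data.Nat using (ℕ; zero; suc; _≡ᵇ_)
open import Data.Nat.Properties using () renaming (_≟_ to _≟ℕ_)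
open import Data.Product using (Σ; ∃-syntax; _×_; _,_; proj₁; proj₂; map₂)
open import Data.Rational using (ℚ; 0ℚ; _+_; _≤_; _<_; _/_)
open import Data.Rational.Properties using (≤-refl; +-monoʳ-≤; +-monoˡ-≤; +-identityˡ; module ≤-Reasoning)
open import Data.Sum using (_⊎_; inj₁; inj₂) renaming (map to ⊎-map)
open import Data.Vec using (Vec; []; _∷_; lookup; tabulate)
open import Function using (_∘_; case_of_) renaming (id to idᶠ)
open import Function.Bundles using (Equivalence; _⇔_; mk⇔)
open import Function.Definitions using (Injective)
open import Relation.Binary.PropositionalEquality using (_≡_; _≢_; refl; sym; trans; cong; subst; module ≡-Reasoning)
open import Relation.Nullary using (Dec; yes; no; does; _because_; ¬_; ¬?; _×-dec_; _→-dec_; _⊎-dec_; map′)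
open import Relation.Nullary.Decidable using (from-yes; dec-true)
open import Relation.Nullary.Reflects using (invert)
open import Relation.Unary using (Decidable)

from-does : ∀ {A : Set} (a? : Dec A) → does a? ≡ true → A
from-does (true because [a]) _ = invert [a]

module _ {n : ℕ} where

  _∉V_ : Fin n → VSet n → Set
  v ∉V X = X v ≡ false

  ∉V⇒¬∈V : ∀ (X : VSet n) {v} → v ∉V X → ¬ v ∈V X
  ∉V⇒¬∈V _ v∉ v∈ with trans (sym v∈) v∉
  ... | ()

  ∈V-or-∉V : ∀ (X : VSet n) v → v ∈V X ⊎ v ∉V X
  ∈V-or-∉V X v with X v
  ... | true  = inj₁ refl
  ... | false = inj₂ refl

  _∪_ : VSet n → VSet n → VSet n
  (X ∪ Y) v = X v ∨ Y v

  ∈∪⁺ˡ : ∀ {X Y : VSet n} {v} → v ∈V X → v ∈V (X ∪ Y)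
  ∈∪⁺ˡ {Y = Y} {v = v} v∈X = cong (_∨ Y v) v∈X

  ∈∪⁺ʳ : ∀ {X Y : VSet n} {v} → v ∈V Y → v ∈V (X ∪ Y)
  ∈∪⁺ʳ {X = X} {v = v} v∈Y = trans (cong (X v ∨_) v∈Y) (∨-zeroʳ (X v))

  ∈∪⁻ : ∀ {X Y : VSet n} {v} → v ∈V (X ∪ Y) → v ∈V X ⊎ v ∈V Y
  ∈∪⁻ {X = X} {v = v} v∈ with X v
  ... | true  = inj₁ refl
  ... | false = inj₂ v∈

  ∈─⁺ : ∀ (X : VSet n) {v z} → v ∈V X → v ≢ z → v ∈V (X ─ z)
  ∈─⁺ X {v} {z} v∈X v≢z with v ≟F z
  ... | yes v≡z = ⊥-elim (v≢z v≡z)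
  ... | no  _   rewrite v∈X = refl

  ∈─⇒∈ : ∀ (X : VSet n) {v z} → v ∈V (X ─ z) → v ∈V X
  ∈─⇒∈ X {v} v∈ with X v
  ... | true  = refl
  ... | false = v∈

  ∈─⇒≢ : ∀ (X : VSet n) {v z} → v ∈V (X ─ z) → v ≢ z
  ∈─⇒≢ X {v} {z} v∈ v≡z with v ≟F z | X v | v∈
  ... | no v≢z | _     | _  = v≢z v≡z
  ... | yes _  | true  | ()
  ... | yes _  | false | ()

  ∈∖─⇔ : ∀ (X : VSet n) {v z} → v ∈V (allV ∖ (X ─ z)) ⇔ (v ∉V X ⊎ v ≡ z)
  ∈∖─⇔ X {v} {z} with X v | v ≟F z
  ... | false | _       = mk⇔ (λ _ → inj₁ refl) (λ _ → refl)
  ... | true  | yes v≡z = mk⇔ (λ _ → inj₂ v≡z) (λ _ → refl)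
  ... | true  | no  v≢z = mk⇔ (λ ()) λ { (inj₁ ()) ; (inj₂ v≡z) → ⊥-elim (v≢z v≡z) }

  other-vertex : ∀ (X : VSet n) {a b} → a ∈V X → b ∈V X → a ≢ b → ∀ z → ∃[ v ] v ∈V X × v ≢ z
  other-vertex X {a} {b} a∈X b∈X a≢b z with a ≟F z
  ... | yes refl = b , b∈X , λ b≡a → a≢b (sym b≡a)
  ... | no  a≢z  = a , a∈X , a≢z

module Walks {n : ℕ} (G : Graph n) where

  open DecMembership (_≟F_ {n}) using (_∈?_)

  adj-sym : ∀ {a b} → adj G a b ≡ true → adj G b a ≡ true
  adj-sym {a} {b} a~b = trans (Graph.sym G b a) a~b

  source∈ : ∀ {X a b} → Walk G X a b → a ∈V X
  source∈ (here a∈X)     = a∈X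
  source∈ (step a∈X _ _) = a∈X

  target∈ : ∀ {X a b} → Walk G X a b → b ∈V X
  target∈ (here b∈X)   = b∈X
  target∈ (step _ _ w) = target∈ w

  walk-⊆ : ∀ {X Y a b} → X ⊆V Y → Walk G X a b → Walk G Y a b
  walk-⊆ X⊆Y (here a∈X)       = here (X⊆Y _ a∈X)
  walk-⊆ X⊆Y (step a∈X a~ w) = step (X⊆Y _ a∈X) a~ (walk-⊆ X⊆Y w)

  infixr 5 _++ʷ_
  _++ʷ_ : ∀ {X a b c} → Walk G X a b → Walk G X b c → Walk G X a c
  here _       ++ʷ w′ = w′
  step p a~ w ++ʷ w′ = step p a~ (w ++ʷ w′)

  edge : ∀ {X a b} → a ∈V X → b ∈V X → adj G a b ≡ true → Walk G X a b
  edge a∈X b∈X a~b = step a∈X a~b (here b∈X)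

  reverse : ∀ {X a b} → Walk G X a b → Walk G X b a
  reverse (here a∈X)       = here a∈X
  reverse (step a∈X a~ w) = reverse w ++ʷ edge (source∈ w) a∈X (adj-sym a~)

  connected-via : ∀ {X} h → (∀ y → y ∈V X → Walk G X y h) → ConnectedOn G X
  connected-via h to-h a b a∈X b∈X = to-h a a∈X ++ʷ reverse (to-h b b∈X)

  vertices : ∀ {X a b} → Walk G X a b → List (Fin n)
  vertices (here {v} _)     = v ∷ []
  vertices (step {u} _ _ w) = u ∷ vertices w

  vertices-walk-⊆ : ∀ {X Y a b} (X⊆Y : X ⊆V Y) (w : Walk G X a b) → vertices (walk-⊆ X⊆Y w) ≡ vertices w
  vertices-walk-⊆ X⊆Y (here _)     = refl
  vertices-walk-⊆ X⊆Y (step _ _ w) = cong (_ ∷_) (vertices-walk-⊆ X⊆Y w)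

  vertices⊆ : ∀ {X a b q} (w : Walk G X a b) → q ∈ vertices w → q ∈V X
  vertices⊆ (here a∈X)     (here refl) = a∈X
  vertices⊆ (step a∈X _ _) (here refl) = a∈X
  vertices⊆ (step _ _ w)   (there q∈)  = vertices⊆ w q∈

  source∈vertices : ∀ {X a b} (w : Walk G X a b) → a ∈ vertices w
  source∈vertices (here _)     = here refl
  source∈vertices (step _ _ _) = here refl

  Path : VSet n → Fin n → Fin n → Set
  Path X a b = Σ (Walk G X a b) λ w → Unique (vertices w)

  suffix : ∀ {X a b y} ((w , _) : Path X a b) → y ∈ vertices w → Path X y b
  suffix (here a∈X , u)         (here refl) = here a∈X , u
  suffix (step a∈X a~ w , u)    (here refl) = step a∈X a~ w , u
  suffix (step _ _ w , _ ∷ u)   (there y∈)  = suffix (w , u) y∈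

  loop-erase : ∀ {X a b} → Walk G X a b → Path X a b
  loop-erase (here a∈X) = here a∈X , [] ∷ []
  loop-erase {a = a} (step a∈X a~ w) with loop-erase w
  ... | w′ , u with a ∈? vertices w′
  ...   | yes a∈w′ = suffix (w′ , u) a∈w′
  ...   | no  a∉w′ = step a∈X a~ w′ , ¬Any⇒All¬ _ a∉w′ ∷ u

  to-target : ∀ {X Z a b y} (w : Walk G X a b) → (∀ q → q ∈ vertices w → q ∈V Z) →
              y ∈ vertices w → Walk G Z y b
  to-target (here _)       ⊆Z (here refl) = here (⊆Z _ (here refl))
  to-target (step _ a~ w) ⊆Z (here refl) =
    step (⊆Z _ (here refl)) a~ (to-target w (λ q q∈ → ⊆Z q (there q∈)) (source∈vertices w))
  to-target (step _ _ w)   ⊆Z (there y∈)  = to-target w (λ q q∈ → ⊆Z q (there q∈)) y∈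

  -- On a path, z lies on at most one side of any other vertex y.
  end-reachable-avoiding : ∀ {X Z a b y z} ((w , _) : Path X a b) →
                           (∀ q → q ∈ vertices w → q ≢ z → q ∈V Z) →
                           y ∈ vertices w → y ≢ z → Walk G Z y a ⊎ Walk G Z y b
  end-reachable-avoiding (here _ , _)     ⊆Z (here refl) y≢z = inj₁ (here (⊆Z _ (here refl) y≢z))
  end-reachable-avoiding (step _ _ _ , _) ⊆Z (here refl) y≢z = inj₁ (here (⊆Z _ (here refl) y≢z))
  end-reachable-avoiding {a = a} {z = z} (step _ a~ w , a∉w ∷ u) ⊆Z (there y∈) y≢z with a ≟F z
  ... | yes refl = inj₂ (to-target w (λ q q∈ → ⊆Z q (there q∈) λ q≡a → All.lookup a∉w q∈ (sym q≡a)) y∈)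
  ... | no  a≢z with end-reachable-avoiding (w , u) (λ q q∈ → ⊆Z q (there q∈)) y∈ y≢z
  ...   | inj₁ y→a′ = inj₁ (y→a′ ++ʷ edge (target∈ y→a′) (⊆Z a (here refl) a≢z) (adj-sym a~))
  ...   | inj₂ y→b  = inj₂ y→b

  onWalk : ∀ {X a b} → Walk G X a b → VSet n
  onWalk w q = does (q ∈? vertices w)

  onWalk⁺ : ∀ {X a b q} (w : Walk G X a b) → q ∈ vertices w → q ∈V onWalk w
  onWalk⁺ w = dec-true (_ ∈? vertices w)

  onWalk⁻ : ∀ {X a b q} (w : Walk G X a b) → q ∈V onWalk w → q ∈ vertices w
  onWalk⁻ w = from-does (_ ∈? vertices w)

module Blocks {n : ℕ} (G : Graph n) where

  open Walks G

  ─-connected : ∀ {D} → ConnectedOn G D → NoCutVertexOn G D → ∀ z → ConnectedOn G (D ─ z)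
  ─-connected {D} conn noCut z with D z in z∈?
  ... | true  = noCut z z∈?
  ... | false = λ p q p∈ q∈ → walk-⊆ (λ r r∈D → ∈─⁺ D r∈D λ { refl → ∉V⇒¬∈V D z∈? r∈D })
                                    (conn p q (∈─⇒∈ D p∈) (∈─⇒∈ D q∈))

  module Ear {D X : VSet n} {a b : Fin n} (P : Walk G X a b) where

    Y : VSet n
    Y = D ∪ onWalk P

    D⊆Y : D ⊆V Y
    D⊆Y _ = ∈∪⁺ˡ {X = D} {Y = onWalk P}

    P⊆Y : ∀ q → q ∈ vertices P → q ∈V Y
    P⊆Y _ q∈ = ∈∪⁺ʳ {X = D} {Y = onWalk P} (onWalk⁺ P q∈)

    Y⊆ : ∀ {y} → y ∈V Y → y ∈V D ⊎ y ∈ vertices P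
    Y⊆ y∈ with ∈∪⁻ {X = D} {Y = onWalk P} y∈
    ... | inj₁ y∈D = inj₁ y∈D
    ... | inj₂ y∈P = inj₂ (onWalk⁻ P y∈P)

    connected : ConnectedOn G D → b ∈V D → ConnectedOn G Y
    connected conn b∈D = connected-via b to-b
      where
      to-b : ∀ y → y ∈V Y → Walk G Y y b
      to-b y y∈ with Y⊆ y∈
      ... | inj₁ y∈D = walk-⊆ D⊆Y (conn y b y∈D b∈D)
      ... | inj₂ y∈P = to-target P P⊆Y y∈P

    noCut : ConnectedOn G D → NoCutVertexOn G D → Unique (vertices P) →
            a ∈V D → b ∈V D → a ≢ b → NoCutVertexOn G Y
    noCut conn noCut-D unique a∈D b∈D a≢b z _ with other-vertex D a∈D b∈D a≢b z
    ... | h , h∈D , h≢z = connected-via h to-h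
      where
      h∈ : h ∈V (D ─ z)
      h∈ = ∈─⁺ D h∈D h≢z
      from-D : ∀ {e} → e ∈V D → e ∈V (Y ─ z) → Walk G (Y ─ z) e h
      from-D e∈D e∈ = walk-⊆ (λ q q∈ → ∈─⁺ Y (D⊆Y q (∈─⇒∈ D q∈)) (∈─⇒≢ D q∈))
                             (─-connected conn noCut-D z _ h (∈─⁺ D e∈D (∈─⇒≢ Y e∈)) h∈)
      to-h : ∀ y → y ∈V (Y ─ z) → Walk G (Y ─ z) y h
      to-h y y∈ with Y⊆ (∈─⇒∈ Y y∈)
      ... | inj₁ y∈D = from-D y∈D y∈
      ... | inj₂ y∈P with end-reachable-avoiding (P , unique)
                            (λ q q∈ q≢z → ∈─⁺ Y (P⊆Y q q∈) q≢z) y∈P (∈─⇒≢ Y y∈)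
      ...   | inj₁ y→a = y→a ++ʷ from-D a∈D (target∈ y→a)
      ...   | inj₂ y→b = y→b ++ʷ from-D b∈D (target∈ y→b)

  outside-neighbor⇒cut : ∀ {D a b u w} → IsBlock G D → a ∈V D → b ∈V D → a ≢ b →
                          u ∈V D → w ∉V D → adj G u w ≡ true → IsCutVertex G u
  outside-neighbor⇒cut {D} {u = u} {w} (conn , noCut-D , maximal) a∈D b∈D a≢b u∈D w∉D u~w G─u-conn
    with other-vertex D a∈D b∈D a≢b u
  ... | v , v∈D , v≢u = ∉V⇒¬∈V D w∉D (maximal Y D⊆Y (connected conn v∈D) noCut-Y w w∈Y)
    where
    w≢u : w ≢ u
    w≢u refl = ∉V⇒¬∈V D w∉D u∈D
    Q : Path (allV ─ u) w v
    Q = loop-erase (G─u-conn w v (∈─⁺ allV refl w≢u) (∈─⁺ allV refl v≢u))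
    W : Walk G allV w v
    W = walk-⊆ (λ _ → ∈─⇒∈ allV) (proj₁ Q)
    u∉W : All (u ≢_) (vertices W)
    u∉W = All.tabulate λ q∈ u≡q → ∈─⇒≢ allV
             (vertices⊆ (proj₁ Q) (subst (_ ∈_) (vertices-walk-⊆ _ (proj₁ Q)) q∈)) (sym u≡q)
    P : Walk G allV u v
    P = step refl u~w W
    open Ear {D} P
    noCut-Y : NoCutVertexOn G Y
    noCut-Y = noCut conn noCut-D (u∉W ∷ subst Unique (sym (vertices-walk-⊆ _ (proj₁ Q))) (proj₂ Q))
                    u∈D v∈D (λ u≡v → v≢u (sym u≡v))
    w∈Y : w ∈V Y
    w∈Y = P⊆Y w (there (source∈vertices W))

  OnlyAttachedAt : VSet n → Fin n → Set
  OnlyAttachedAt D x = ∀ {y w} → y ∈V D → y ≢ x → adj G y w ≡ true → w ∈V D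

  terminal-block-attachment : ∀ {D a b} → IsTerminalBlock G D → a ∈V D → b ∈V D → a ≢ b →
                              ∃[ x ] x ∈V D × OnlyAttachedAt D x
  terminal-block-attachment {D} {a} (block , atMostOneCut) a∈D b∈D a≢b
    with any? (λ y → any? (λ w → (D y ≟B true) ×-dec (D w ≟B false) ×-dec (adj G y w ≟B true)))
  ... | yes (x , w₀ , x∈D , w₀∉D , x~w₀) = x , x∈D , attached
    where
    cut : ∀ {y w} → y ∈V D → w ∉V D → adj G y w ≡ true → IsCutVertex G y
    cut = outside-neighbor⇒cut block a∈D b∈D a≢b
    attached : OnlyAttachedAt D x
    attached {y} {w} y∈D y≢x y~w with D w in w∈?
    ... | true  = refl
    ... | false = ⊥-elim (y≢x (atMostOneCut y x y∈D x∈D (cut y∈D w∈? y~w) (cut x∈D w₀∉D x~w₀)))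
  ... | no none = a , a∈D , attached
    where
    attached : OnlyAttachedAt D a
    attached {y} {w} y∈D _ y~w with D w in w∈?
    ... | true  = refl
    ... | false = ⊥-elim (none (y , w , y∈D , w∈? , y~w))

open Walks using (adj-sym)
open Blocks using (OnlyAttachedAt; terminal-block-attachment)

Exhaustive : Set → Set₁
Exhaustive A = ∀ {P : A → Set} → Decidable P → Dec (∀ a → P a)

Bool-exhaustive : Exhaustive Bool
Bool-exhaustive P? =
  map′ (λ { (f , t) false → f ; (f , t) true → t }) (λ h → h false , h true) (P? false ×-dec P? true)

Vec-exhaustive : ∀ {A} → Exhaustive A → ∀ n → Exhaustive (Vec A n)
Vec-exhaustive A? zero    P? = map′ (λ { p [] → p }) (λ h → h []) (P? [])
Vec-exhaustive A? (suc n) P? =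
  map′ (λ { h (a ∷ v) → h a v }) (λ h a v → h (a ∷ v)) (A? λ a → Vec-exhaustive A? n λ v → P? (a ∷ v))

Matrix : Set
Matrix = Fin 3 → Fin 3 → Bool

Table : Set
Table = Vec (Vec Bool 3) 3

fromTable : Table → Matrix
fromTable V i k = lookup (lookup V i) k

toTable : Matrix → Table
toTable M = tabulate λ i → tabulate (M i)

all-tables : ∀ {P : Table → Set} → Decidable P → Dec (∀ V → P V)
all-tables = Vec-exhaustive (Vec-exhaustive Bool-exhaustive 3) 3

permutations₃ : List (Permutation′ 3)
permutations₃ = id ∷ transpose 0F 1F ∷ transpose 0F 2F ∷ transpose 1F 2F
              ∷ transpose 0F 1F ∘ₚ transpose 1F 2F ∷ transpose 1F 2F ∘ₚ transpose 0F 1F ∷ []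

HallCondition : Matrix → Set
HallCondition B =
  (∀ i → ¬ (∀ k → B i k ≡ true)) × (∀ k → ¬ (∀ i → B i k ≡ true)) ×
  (∀ i j k l → i ≢ j → k ≢ l → ¬ (B i k ≡ true × B i l ≡ true × B j k ≡ true × B j l ≡ true))

Transversal : Matrix → Permutation′ 3 → Set
Transversal B π = ∀ i → B i (π ⟨$⟩ʳ i) ≢ true

hall? : ∀ B → Dec (HallCondition B → Any (Transversal B) permutations₃)
hall? B = condition? →-dec Any.any? (λ π → all? λ i → ¬? (B i (π ⟨$⟩ʳ i) ≟B true)) permutations₃
  where
  condition? =
    (all? λ i → ¬? (all? λ k → B i k ≟B true)) ×-dec (all? λ k → ¬? (all? λ i → B i k ≟B true)) ×-dec
    (all? λ i → all? λ j → all? λ k → all? λ l → ¬? (i ≟F j) →-dec ¬? (k ≟F l) →-dec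
       ¬? ((B i k ≟B true) ×-dec (B i l ≟B true) ×-dec (B j k ≟B true) ×-dec (B j l ≟B true)))

-- Hall's theorem for 3 × 3 matrices (B i k = true: column k is blocked in row i), checked on all
-- 512 tables.  `hall?` reads B only at literal indices, so its verdict on `fromTable (toTable B)`
-- is definitionally its verdict on B.  Opaque, so that conversion checks never unfold the 512 cases.
opaque
  hall₃ : ∀ B → HallCondition B → ∃[ π ] Transversal B π
  hall₃ B = satisfied ∘ from-does (hall? B) (all-tables-pass (toTable B))
    where
    all-tables-pass : ∀ V → does (hall? (fromTable V)) ≡ true
    all-tables-pass = from-yes (all-tables λ V → does (hall? (fromTable V)) ≟B true)

PartialPermutation : Matrix → Set
PartialPermutation E =
  (∀ i k l → E i k ≡ true → E i l ≡ true → k ≡ l) × (∀ i j k → E i k ≡ true → E j k ≡ true → i ≡ j)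

SwapFreeAvoiding : Matrix → Permutation′ 3 → Set
SwapFreeAvoiding E π =
  (∀ i → E i (π ⟨$⟩ʳ i) ≢ true) × (∀ i j → E i (π ⟨$⟩ʳ j) ≡ true → E j (π ⟨$⟩ʳ i) ≡ true → i ≡ j)

swap-free? : ∀ E → Dec (PartialPermutation E → Any (SwapFreeAvoiding E) permutations₃)
swap-free? E = partial? →-dec Any.any? avoiding? permutations₃
  where
  partial? =
    (all? λ i → all? λ k → all? λ l → (E i k ≟B true) →-dec (E i l ≟B true) →-dec (k ≟F l)) ×-dec
    (all? λ i → all? λ j → all? λ k → (E i k ≟B true) →-dec (E j k ≟B true) →-dec (i ≟F j))
  avoiding? = λ π →
    (all? λ i → ¬? (E i (π ⟨$⟩ʳ i) ≟B true)) ×-dec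
    (all? λ i → all? λ j → (E i (π ⟨$⟩ʳ j) ≟B true) →-dec (E j (π ⟨$⟩ʳ i) ≟B true) →-dec (i ≟F j))

opaque
  swap-free₃ : ∀ E → PartialPermutation E → ∃[ π ] SwapFreeAvoiding E π
  swap-free₃ E = satisfied ∘ from-does (swap-free? E) (all-tables-pass (toTable E))
    where
    all-tables-pass : ∀ V → does (swap-free? (fromTable V)) ≡ true
    all-tables-pass = from-yes (all-tables λ V → does (swap-free? (fromTable V)) ≟B true)

¬three-into-two : ∀ {u v : Fin 3 → ℕ} {c d} → Injective _≡_ _≡_ u → Injective _≡_ _≡_ v →
                 ¬ (∀ i → u i ≡ c ⊎ v i ≡ d)
¬three-into-two u-inj v-inj h with h 0F | h 1F | h 2F
... | inj₁ p | inj₁ q | _      with () ← u-inj (trans p (sym q))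
... | inj₂ p | inj₂ q | _      with () ← v-inj (trans p (sym q))
... | inj₁ p | inj₂ _ | inj₁ r with () ← u-inj (trans p (sym r))
... | inj₂ _ | inj₁ q | inj₁ r with () ← u-inj (trans q (sym r))
... | inj₁ _ | inj₂ q | inj₂ r with () ← v-inj (trans q (sym r))
... | inj₂ p | inj₁ _ | inj₂ r with () ← v-inj (trans p (sym r))

NoSwap : (s t : Fin 3 → ℕ) → Set
NoSwap s t = ∀ i j → s i ≡ t j → s j ≡ t i → i ≡ j

edge-pairing : ∀ {s t : Fin 3 → ℕ} → Injective _≡_ _≡_ s → Injective _≡_ _≡_ t →
               ∃[ π ] (∀ i → s i ≢ t (π ⟨$⟩ʳ i)) × NoSwap s (t ∘ (π ⟨$⟩ʳ_))
edge-pairing {s} {t} s-inj t-inj =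
  let π , avoids , swap-free = swap-free₃ E (rows , columns)
  in π , (λ i → avoids i ∘ dec-true (s i ≟ℕ _)) ,
     (λ i j p q → swap-free i j (dec-true (s i ≟ℕ _) p) (dec-true (s j ≟ℕ _) q))
  where
  E : Matrix
  E i k = does (s i ≟ℕ t k)
  rows : ∀ i k l → E i k ≡ true → E i l ≡ true → k ≡ l
  rows i k l p q = t-inj (trans (sym (from-does (s i ≟ℕ t k) p)) (from-does (s i ≟ℕ t l) q))
  columns : ∀ i j k → E i k ≡ true → E j k ≡ true → i ≡ j
  columns i j k p q = s-inj (trans (from-does (s i ≟ℕ t k) p) (sym (from-does (s j ≟ℕ t k) q)))

common-neighbor : ∀ {u s t : Fin 3 → ℕ} → Injective _≡_ _≡_ u → Injective _≡_ _≡_ s →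
                   Injective _≡_ _≡_ t → NoSwap s t →
                   ∃[ π ] ∀ i → u (π ⟨$⟩ʳ i) ≢ s i × u (π ⟨$⟩ʳ i) ≢ t i
common-neighbor {u} {s} {t} u-inj s-inj t-inj no-swap =
  let π , transversal = hall₃ B (rows , columns , squares)
  in π , λ i → (λ p → transversal i (dec-true (blocked? i _) (inj₁ p))) ,
               (λ q → transversal i (dec-true (blocked? i _) (inj₂ q)))
  where
  blocked? : ∀ i k → Dec (u k ≡ s i ⊎ u k ≡ t i)
  blocked? i k = (u k ≟ℕ s i) ⊎-dec (u k ≟ℕ t i)
  B : Matrix
  B i k = does (blocked? i k)
  rows : ∀ i → ¬ (∀ k → B i k ≡ true)
  rows i all = ¬three-into-two u-inj u-inj λ k → from-does (blocked? i k) (all k)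
  columns : ∀ k → ¬ (∀ i → B i k ≡ true)
  columns k all = ¬three-into-two s-inj t-inj λ i → ⊎-map sym sym (from-does (blocked? i k) (all i))
  pair : ∀ {r k l} → k ≢ l → B r k ≡ true → B r l ≡ true →
         (u k ≡ s r × u l ≡ t r) ⊎ (u k ≡ t r × u l ≡ s r)
  pair {r} {k} {l} k≢l p q with from-does (blocked? r k) p | from-does (blocked? r l) q
  ... | inj₁ ks | inj₂ lt = inj₁ (ks , lt)
  ... | inj₂ kt | inj₁ ls = inj₂ (kt , ls)
  ... | inj₁ ks | inj₁ ls = ⊥-elim (k≢l (u-inj (trans ks (sym ls))))
  ... | inj₂ kt | inj₂ lt = ⊥-elim (k≢l (u-inj (trans kt (sym lt))))
  squares : ∀ i j k l → i ≢ j → k ≢ l → ¬ (B i k ≡ true × B i l ≡ true × B j k ≡ true × B j l ≡ true)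
  squares i j k l i≢j k≢l (ik , il , jk , jl) with pair k≢l ik il | pair k≢l jk jl
  ... | inj₁ (ks , _)  | inj₁ (ks′ , _)  = i≢j (s-inj (trans (sym ks) ks′))
  ... | inj₂ (kt , _)  | inj₂ (kt′ , _)  = i≢j (t-inj (trans (sym kt) kt′))
  ... | inj₁ (ks , lt) | inj₂ (kt′ , ls′) = i≢j (no-swap i j (trans (sym ks) kt′) (trans (sym ls′) lt))
  ... | inj₂ (kt , ls) | inj₁ (ks′ , lt′) = i≢j (no-swap i j (trans (sym ls) lt′) (trans (sym ks′) kt))

record Enumerates {k} (u : Fin k → ℕ) (xs : List ℕ) : Set where
  field
    injective : Injective _≡_ _≡_ u
    ∈-list    : ∀ i → u i ∈ xs
    onto      : ∀ {c} → c ∈ xs → ∃[ i ] u i ≡ c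

enumerate : ∀ xs → length xs ≡ 3 → Unique xs → Σ (Fin 3 → ℕ) λ u → Enumerates u xs
enumerate (a ∷ b ∷ c ∷ []) refl ((a≢b ∷ a≢c ∷ []) ∷ (b≢c ∷ []) ∷ [] ∷ []) = u , record
  { injective = injective ; ∈-list = ∈-list ; onto = onto }
  where
  u : Fin 3 → ℕ
  u 0F = a
  u 1F = b
  u 2F = c
  injective : Injective _≡_ _≡_ u
  injective {0F} {0F} _ = refl
  injective {1F} {1F} _ = refl
  injective {2F} {2F} _ = refl
  injective {0F} {1F} p = ⊥-elim (a≢b p)
  injective {0F} {2F} p = ⊥-elim (a≢c p)
  injective {1F} {2F} p = ⊥-elim (b≢c p)
  injective {1F} {0F} p = ⊥-elim (a≢b (sym p))
  injective {2F} {0F} p = ⊥-elim (a≢c (sym p))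
  injective {2F} {1F} p = ⊥-elim (b≢c (sym p))
  ∈-list : ∀ i → u i ∈ (a ∷ b ∷ c ∷ [])
  ∈-list 0F = here refl
  ∈-list 1F = there (here refl)
  ∈-list 2F = there (there (here refl))
  onto : ∀ {x} → x ∈ (a ∷ b ∷ c ∷ []) → ∃[ i ] u i ≡ x
  onto (here refl)                 = 0F , refl
  onto (there (here refl))         = 1F , refl
  onto (there (there (here refl))) = 2F , refl

Enumerates-∘ : ∀ {k u xs} → Enumerates u xs → (π : Permutation′ k) → Enumerates (u ∘ (π ⟨$⟩ʳ_)) xs
Enumerates-∘ {u = u} e π = record
  { injective = λ {i} {j} p → trans (sym (inverseˡ π)) (trans (cong (π ⟨$⟩ˡ_) (injective p)) (inverseˡ π))
  ; ∈-list    = ∈-list ∘ (π ⟨$⟩ʳ_)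
  ; onto      = λ c∈ → let i , uᵢ≡c = onto c∈ in π ⟨$⟩ˡ i , trans (cong u (inverseʳ π)) uᵢ≡c
  }
  where open Enumerates e

-- `position u c` is a junk `zero` when c is not a value of u.
position : ∀ {k} → (Fin (suc k) → ℕ) → ℕ → Fin (suc k)
position u c with any? (λ i → u i ≟ℕ c)
... | yes (i , _) = i
... | no  _       = 0F

position-correct : ∀ {k} {u : Fin (suc k) → ℕ} {i c} → Injective _≡_ _≡_ u → u i ≡ c → position u c ≡ i
position-correct {u = u} {c = c} u-inj uᵢ≡c with any? (λ i → u i ≟ℕ c)
... | yes (j , uⱼ≡c) = u-inj (trans uⱼ≡c (sym uᵢ≡c))
... | no  none       = ⊥-elim (none (_ , uᵢ≡c))

position-∈ : ∀ {k} {u : Fin (suc k) → ℕ} {xs c} → Enumerates u xs → c ∈ xs → u (position u c) ≡ c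
position-∈ {u = u} e c∈ = trans (cong u (position-correct injective uᵢ≡c)) uᵢ≡c
  where
  open Enumerates e
  uᵢ≡c = proj₂ (onto c∈)

record ListPacking {m} (H : Fin m → Fin m → Bool) (ℓ : Fin m → List ℕ) : Set where
  field
    color      : Fin m → Fin 3 → ℕ
    enumerates : ∀ j → Enumerates (color j) (ℓ j)
    proper     : ∀ {j k} → H j k ≡ true → ∀ i → color j i ≢ color k i

diamond-packing : (ℓ : Fin 4 → List ℕ) → (∀ j → length (ℓ j) ≡ 3) → (∀ j → Unique (ℓ j)) →
                  ListPacking diamondAdj ℓ
diamond-packing ℓ size unique = record { color = color ; enumerates = enumerates ; proper = proper }
  where
  enum : ∀ j → Σ (Fin 3 → ℕ) λ u → Enumerates u (ℓ j)
  enum j = enumerate (ℓ j) (size j) (unique j)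
  u : Fin 4 → Fin 3 → ℕ
  u j = proj₁ (enum j)
  u-inj : ∀ j → Injective _≡_ _≡_ (u j)
  u-inj j = Enumerates.injective (proj₂ (enum j))
  middle : ∃[ π ] (∀ i → u 1F i ≢ u 2F (π ⟨$⟩ʳ i)) × NoSwap (u 1F) (u 2F ∘ (π ⟨$⟩ʳ_))
  middle = edge-pairing (u-inj 1F) (u-inj 2F)
  c : Fin 3 → ℕ
  c = u 2F ∘ (proj₁ middle ⟨$⟩ʳ_)
  apex : ∀ j → ∃[ π ] ∀ i → u j (π ⟨$⟩ʳ i) ≢ u 1F i × u j (π ⟨$⟩ʳ i) ≢ c i
  apex j = common-neighbor (u-inj j) (u-inj 1F)
             (Enumerates.injective (Enumerates-∘ (proj₂ (enum 2F)) (proj₁ middle))) (proj₂ (proj₂ middle))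
  π : Fin 4 → Permutation′ 3
  π 0F = proj₁ (apex 0F)
  π 1F = id
  π 2F = proj₁ middle
  π 3F = proj₁ (apex 3F)
  color : Fin 4 → Fin 3 → ℕ
  color j = u j ∘ (π j ⟨$⟩ʳ_)
  enumerates : ∀ j → Enumerates (color j) (ℓ j)
  enumerates j = Enumerates-∘ (proj₂ (enum j)) (π j)
  proper : ∀ {j k} → diamondAdj j k ≡ true → ∀ i → color j i ≢ color k i
  proper {0F} {1F} _ i = proj₁ (proj₂ (apex 0F) i)
  proper {0F} {2F} _ i = proj₂ (proj₂ (apex 0F) i)
  proper {3F} {1F} _ i = proj₁ (proj₂ (apex 3F) i)
  proper {3F} {2F} _ i = proj₂ (proj₂ (apex 3F) i)
  proper {1F} {2F} _ i = proj₁ (proj₂ middle) i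
  proper {1F} {0F} _ i = proj₁ (proj₂ (apex 0F) i) ∘ sym
  proper {2F} {0F} _ i = proj₂ (proj₂ (apex 0F) i) ∘ sym
  proper {1F} {3F} _ i = proj₁ (proj₂ (apex 3F) i) ∘ sym
  proper {2F} {3F} _ i = proj₂ (proj₂ (apex 3F) i) ∘ sym
  proper {2F} {1F} _ i = proj₁ (proj₂ middle) i ∘ sym
  proper {0F} {0F} ()
  proper {0F} {3F} ()
  proper {1F} {1F} ()
  proper {2F} {2F} ()
  proper {3F} {0F} ()
  proper {3F} {3F} ()

mapColorings : ∀ {n} → (Coloring n → Coloring n) → Weighted n → Weighted n
mapColorings g = map (map₂ g)

module _ {n : ℕ} where

  Pr-map : ∀ (g : Coloring n → Coloring n) d e → Pr (mapColorings g d) e ≡ Pr d (e ∘ g)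
  Pr-map g []            e = refl
  Pr-map g ((w , φ) ∷ d) e with e (g φ)
  ... | true  = cong (_+_ w) (Pr-map g d e)
  ... | false = Pr-map g d e

  totalWeight-map : ∀ (g : Coloring n → Coloring n) d → totalWeight (mapColorings g d) ≡ totalWeight d
  totalWeight-map g []            = refl
  totalWeight-map g ((w , _) ∷ d) = cong (_+_ w) (totalWeight-map g d)

  Pr-mono : ∀ (d : Weighted n) {e₁ e₂} → All (λ p → 0ℚ ≤ proj₁ p) d →
            All (λ p → e₁ (proj₂ p) ≡ true → e₂ (proj₂ p) ≡ true) d → Pr d e₁ ≤ Pr d e₂
  Pr-mono []            _          _          = ≤-refl
  Pr-mono ((w , φ) ∷ d) {e₁} {e₂} (0≤w ∷ nonneg) (imp ∷ imps) with e₁ φ | e₂ φ | imp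
  ... | true  | true  | _ = +-monoʳ-≤ w (Pr-mono d nonneg imps)
  ... | true  | false | i with () ← i refl
  ... | false | false | _ = Pr-mono d nonneg imps
  ... | false | true  | _ = begin
    Pr d e₁       ≤⟨ Pr-mono d nonneg imps ⟩
    Pr d e₂       ≡⟨ +-identityˡ (Pr d e₂) ⟨
    0ℚ + Pr d e₂  ≤⟨ +-monoˡ-≤ (Pr d e₂) 0≤w ⟩
    w + Pr d e₂   ∎
    where open ≤-Reasoning

  module _ {G : Graph n} {L : Assignment3 n} {X Y : VSet n} (g : Coloring n → Coloring n) where

    record Simulated (v : Fin n) : Set where
      field
        source      : Fin n
        source∈X    : source ∈V X
        translate   : ℕ → ℕ
        translate-∈ : ∀ {c} → c ∈ lists L v → translate c ∈ lists L source
        sound       : ∀ {φ c} → IsLColoringOn G L X φ → c ∈ lists L v →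
                      φ source ≡ translate c → g φ v ≡ c
        complete    : ∀ {φ c} → IsLColoringOn G L X φ → g φ v ≡ c → φ source ≡ translate c

    pushforward : ∀ {ε α} → (∀ {φ} → IsLColoringOn G L X φ → IsLColoringOn G L Y (g φ)) →
                  (∀ {v} → v ∈V Y → Simulated v) → Has3Dist G L X ε α → Has3Dist G L Y ε α
    pushforward {ε} {α} g-coloring simulated (dist , lower , upper) = dist′ , lower′ , upper′
      where
      d : Weighted n
      d = support dist
      dist′ : DistOn G L Y
      dist′ = record
        { support   = mapColorings g d
        ; nonneg    = map⁺ (nonneg dist)
        ; sumOne    = trans (totalWeight-map g d) (sumOne dist)
        ; colorings = map⁺ (All.map g-coloring (colorings dist))
        }
      transfer : ∀ {e₁ e₂} → (∀ {φ} → IsLColoringOn G L X φ → e₁ φ ≡ true → e₂ φ ≡ true) →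
                 Pr d e₁ ≤ Pr d e₂
      transfer implication = Pr-mono d (nonneg dist) (All.map implication (colorings dist))
      open ≤-Reasoning
      lower′ : ∀ v c → v ∈V Y → c ∈ lists L v → ε ≤ Pr (support dist′) (λ φ → φ v ≡ᵇ c)
      lower′ v c v∈Y c∈ = begin
        ε                                      ≤⟨ lower source (translate c) source∈X (translate-∈ c∈) ⟩
        Pr d (λ φ → φ source ≡ᵇ translate c)   ≤⟨ transfer implication ⟩
        Pr d (λ φ → g φ v ≡ᵇ c)                ≡⟨ Pr-map g d _ ⟨
        Pr (mapColorings g d) (λ φ → φ v ≡ᵇ c) ∎
        where
        open Simulated (simulated v∈Y)
        implication : ∀ {φ} → IsLColoringOn G L X φ →
                      (φ source ≡ᵇ translate c) ≡ true → (g φ v ≡ᵇ c) ≡ true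
        implication col = dec-true (_ ≟ℕ c) ∘ sound col c∈ ∘ from-does (_ ≟ℕ _)
      upper′ : ∀ v c → v ∈V Y → α ≤ Pr (support dist′) (λ φ → not (φ v ≡ᵇ c))
      upper′ v c v∈Y = begin
        α                                            ≤⟨ upper source (translate c) source∈X ⟩
        Pr d (λ φ → not (φ source ≡ᵇ translate c))   ≤⟨ transfer implication ⟩
        Pr d (λ φ → not (g φ v ≡ᵇ c))                ≡⟨ Pr-map g d _ ⟨
        Pr (mapColorings g d) (λ φ → not (φ v ≡ᵇ c)) ∎
        where
        open Simulated (simulated v∈Y)
        implication : ∀ {φ} → IsLColoringOn G L X φ →
                      not (φ source ≡ᵇ translate c) ≡ true → not (g φ v ≡ᵇ c) ≡ true
        implication col p = dec-true (¬? (_ ≟ℕ c)) (from-does (¬? (_ ≟ℕ _)) p ∘ complete col)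

module Recoloring {n m : ℕ} (G : Graph n) (L : Assignment3 n) (D : VSet n)
  (f : Fin m → Fin n) (f-inj : Injective _≡_ _≡_ f) (f∈D : ∀ j → f j ∈V D)
  (f-onto : ∀ v → v ∈V D → ∃[ j ] f j ≡ v)
  (H : Fin m → Fin m → Bool) (f-adj : ∀ j k → adj G (f j) (f k) ≡ H j k)
  (jx : Fin m) (attached : OnlyAttachedAt G D (f jx))
  (packing : ListPacking H (lists L ∘ f)) where

  open ListPacking packing
  open Enumerates using (∈-list)

  color-injective : ∀ j → Injective _≡_ _≡_ (color j)
  color-injective j = Enumerates.injective (enumerates j)

  x : Fin n
  x = f jx

  S : VSet n
  S = D ─ x

  Coloring-G∖S : Coloring n → Set
  Coloring-G∖S = IsLColoringOn G L (allV ∖ S)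

  slot : Coloring n → Fin 3
  slot φ = position (color jx) (φ x)

  recolor : Coloring n → Coloring n
  recolor φ v with any? (λ j → f j ≟F v)
  ... | yes (j , _) = color j (slot φ)
  ... | no  _       = φ v

  recolor-f : ∀ φ j → recolor φ (f j) ≡ color j (slot φ)
  recolor-f φ j with any? (λ k → f k ≟F f j)
  ... | yes (k , fₖ≡fⱼ) = cong (λ k → color k (slot φ)) (f-inj fₖ≡fⱼ)
  ... | no  none        = ⊥-elim (none (j , refl))

  recolor-outside : ∀ φ {v} → v ∉V D → recolor φ v ≡ φ v
  recolor-outside φ {v} v∉D with any? (λ j → f j ≟F v)
  ... | yes (j , refl) = ⊥-elim (∉V⇒¬∈V D v∉D (f∈D j))
  ... | no  _          = refl

  vertex-cases : ∀ v → (∃[ j ] f j ≡ v) ⊎ v ∉V D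
  vertex-cases v with ∈V-or-∉V D v
  ... | inj₁ v∈D = inj₁ (f-onto v v∈D)
  ... | inj₂ v∉D = inj₂ v∉D

  ∉S⇔ : ∀ {v} → v ∈V (allV ∖ S) ⇔ (v ∉V D ⊎ v ≡ x)
  ∉S⇔ = ∈∖─⇔ D

  x∉S : x ∈V (allV ∖ S)
  x∉S = Equivalence.from ∉S⇔ (inj₂ refl)

  outside∉S : ∀ {v} → v ∉V D → v ∈V (allV ∖ S)
  outside∉S v∉D = Equivalence.from ∉S⇔ (inj₁ v∉D)

  ∉S-if-outside-neighbor : ∀ {u v} → v ∉V D → adj G u v ≡ true → u ∈V (allV ∖ S)
  ∉S-if-outside-neighbor {u} v∉D u~v = Equivalence.from ∉S⇔ u∉D-or-x
    where
    u∉D-or-x : u ∉V D ⊎ u ≡ x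
    u∉D-or-x with ∈V-or-∉V D u | u ≟F x
    ... | inj₂ u∉D | _       = inj₁ u∉D
    ... | inj₁ _   | yes u≡x = inj₂ u≡x
    ... | inj₁ u∈D | no  u≢x = ⊥-elim (∉V⇒¬∈V D v∉D (attached u∈D u≢x u~v))

  recolor-agrees : ∀ {φ v} → Coloring-G∖S φ → v ∈V (allV ∖ S) → recolor φ v ≡ φ v
  recolor-agrees {φ} col v∉S with Equivalence.to ∉S⇔ v∉S
  ... | inj₁ v∉D = recolor-outside φ v∉D
  ... | inj₂ refl = trans (recolor-f φ jx) (position-∈ (enumerates jx) (proj₁ col x x∉S))

  recolor-coloring : ∀ {φ} → Coloring-G∖S φ → IsLColoringOn G L allV (recolor φ)
  recolor-coloring {φ} col = in-lists , proper-edges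
    where
    in-lists : ∀ v → v ∈V allV → recolor φ v ∈ lists L v
    in-lists v _ with vertex-cases v
    ... | inj₁ (j , refl) = subst (_∈ lists L (f j)) (sym (recolor-f φ j)) (∈-list (enumerates j) _)
    ... | inj₂ v∉D = subst (_∈ lists L v) (sym (recolor-outside φ v∉D)) (proj₁ col v (outside∉S v∉D))
    agreeing : ∀ {u v} → adj G u v ≡ true → u ∈V (allV ∖ S) → v ∈V (allV ∖ S) → recolor φ u ≢ recolor φ v
    agreeing {u} {v} u~v u∉S v∉S same = proj₂ col u v u∉S v∉S u~v
      (trans (sym (recolor-agrees col u∉S)) (trans same (recolor-agrees col v∉S)))
    proper-edges : ∀ u v → u ∈V allV → v ∈V allV → adj G u v ≡ true → recolor φ u ≢ recolor φ v
    proper-edges u v _ _ u~v with vertex-cases u | vertex-cases v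
    ... | inj₁ (j , refl) | inj₁ (k , refl) = λ same → proper (trans (sym (f-adj j k)) u~v) (slot φ)
                                                 (trans (sym (recolor-f φ j)) (trans same (recolor-f φ k)))
    ... | _        | inj₂ v∉D = agreeing u~v (∉S-if-outside-neighbor v∉D u~v) (outside∉S v∉D)
    ... | inj₂ u∉D | _        = agreeing u~v (outside∉S u∉D)
                                  (∉S-if-outside-neighbor u∉D (adj-sym G u~v))

  simulated : ∀ {v} → v ∈V allV → Simulated {G = G} {L} {allV ∖ S} {allV} recolor v
  simulated {v} _ with vertex-cases v
  ... | inj₂ v∉D = record
    { source = v ; source∈X = outside∉S v∉D ; translate = idᶠ ; translate-∈ = idᶠ
    ; sound = λ col _ φᵥ≡c → trans (recolor-agrees col (outside∉S v∉D)) φᵥ≡c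
    ; complete = λ col same → trans (sym (recolor-agrees col (outside∉S v∉D))) same
    }
  ... | inj₁ (j , refl) = record
    { source = x ; source∈X = x∉S ; translate = translate ; translate-∈ = λ _ → ∈-list (enumerates jx) _
    ; sound = sound ; complete = complete
    }
    where
    open ≡-Reasoning
    translate : ℕ → ℕ
    translate c = color jx (position (color j) c)
    sound : ∀ {φ c} → Coloring-G∖S φ → c ∈ lists L (f j) → φ x ≡ translate c → recolor φ (f j) ≡ c
    sound {φ} {c} _ c∈ φₓ≡ = begin
      recolor φ (f j)                            ≡⟨ recolor-f φ j ⟩
      color j (position (color jx) (φ x))        ≡⟨ cong (color j ∘ position (color jx)) φₓ≡ ⟩
      color j (position (color jx) (translate c)) ≡⟨ cong (color j) (position-correct (color-injective jx) refl) ⟩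
      color j (position (color j) c)             ≡⟨ position-∈ (enumerates j) c∈ ⟩
      c                                          ∎
    complete : ∀ {φ c} → Coloring-G∖S φ → recolor φ (f j) ≡ c → φ x ≡ translate c
    complete {φ} {c} col same = begin
      φ x               ≡⟨ recolor-agrees col x∉S ⟨
      recolor φ x       ≡⟨ recolor-f φ jx ⟩
      color jx (slot φ) ≡⟨ cong (color jx) position≡slot ⟨
      translate c       ∎
      where
      position≡slot : position (color j) c ≡ slot φ
      position≡slot = position-correct (color-injective j) (trans (sym (recolor-f φ j)) same)

  extend : ∀ {ε α} → Has3Dist G L (allV ∖ S) ε α → Has3Dist G L allV ε α
  extend = pushforward recolor recolor-coloring simulated

lemma3p2 : ∀ {n : ℕ} (G : Graph n) → Connected G →
    ∀ (D : VSet n) → IsTerminalBlock G D → IsDiamond G D →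
    ∀ (ε α : ℚ) → 0ℚ < ε → ε ≤ α → α ≤ + 1 / 3 →
    IsReducible G D ε α
lemma3p2 G _ D terminal (f , f-inj , f∈D , f-onto , f-adj) ε α _ _ _ =
  let f₀≢f₁ = λ p → case f-inj p of λ ()
      x , x∈D , attached = terminal-block-attachment G terminal (f∈D 0F) (f∈D 1F) f₀≢f₁
      jx , fjx≡x = f-onto x x∈D
      v , v∈D , v≢fjx = other-vertex D (f∈D 0F) (f∈D 1F) f₀≢f₁ (f jx)
  in D ─ f jx , (λ _ → ∈─⇒∈ D) , (v , ∈─⁺ D v∈D v≢fjx) , λ L →
     Recoloring.extend G L D f f-inj f∈D f-onto diamondAdj f-adj jx
       (subst (OnlyAttachedAt G D) (sym fjx≡x) attached)
       (diamond-packing (lists L ∘ f) (size3 L ∘ f) (distinct L ∘ f))
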